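{- Let $P=(\{\mathit{black},\mathit{white}\},A^\oplus,A^\ominus)$ be a pattern graph such that the directed graph $(\{\mathit{black},\mathit{white}\},A^\oplus\cup A^\ominus)$ contains a cycle, but neither $(\{\mathit{black},\mathit{white}\},A^\oplus)$ nor $(\{\mathit{black},\mathit{white}\},A^\ominus)$ contains a cycle (self-loops count as cycles). Then $\mathrm{SATURATION}(P)\in\mathsf{FO}$.
   Context: A basic graph $B=(V,E)$ is a finite undirected graph without self-loops. A pattern graph $P=(C,A^\oplus,A^\ominus)$ consists of a finite set $C$ of colors and sets $A^\oplus,A^\ominus\subseteq C\times C$. A coloring of $B$ is $c:V\to C$; a witness function for $c$ is $w:V\to V$ with, for all $x$: $x\neq w(x)$; if $\{x,w(x)\}\in E$ then $(c(x),c(w(x)))\in A^\oplus$; if $\{x,w(x)\}\notin E$ then $(c(x),c(w(x)))\in A^\ominus$. $\mathrm{SATURATION}(P)$ is the set of basic graphs admitting a coloring with a witness function. $\mathsf{FO}$ is the class of sets of graphs definable in first-order logic with the BIT predicate (logarithmic-time-uniform $\mathsf{AC}^0$). -}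

module Defs where

open import Data.Nat using (ℕ; zero; suc; _/_; _%_)
open import Data.Fin using (Fin; toℕ; _<_)
open import Data.Bool using (Bool; true; false; _∨_)
open import Data.Product using (Σ; _×_; ∃)
open import Data.Sum using (_⊎_)
open import Data.Empty using (⊥)
open import Relation.Nullary using (¬_)
open import Relation.Binary.PropositionalEquality using (_≡_; _≢_)
open import Relation.Binary.Construct.Closure.Transitive using (TransClosure)
open import Function.Bundles using (_⇔_)

record BasicGraph (n : ℕ) : Set where
  field
    adj   : Fin n → Fin n → Bool
    sym   : ∀ x y → adj x y ≡ adj y x
    irrefl : ∀ x → adj x x ≡ false
open BasicGraph public

data Colour : Set where
  black white : Colour

record Pattern : Set where
  field
    A⊕ : Colour → Colour → Bool
    A⊖ : Colour → Colour → Bool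
open Pattern public

IsWitness : ∀ {n} (P : Pattern) (G : BasicGraph n) (c : Fin n → Colour) (w : Fin n → Fin n) → Set
IsWitness P G c w = ∀ x →
    (x ≢ w x)
  × (adj G x (w x) ≡ true  → A⊕ P (c x) (c (w x)) ≡ true)
  × (adj G x (w x) ≡ false → A⊖ P (c x) (c (w x)) ≡ true)

Saturation : (P : Pattern) → ∀ n → BasicGraph n → Set
Saturation P n G = Σ (Fin n → Colour) λ c → Σ (Fin n → Fin n) λ w → IsWitness P G c w

-- Directed graphs on the colours, given by a Boolean arc relation.
-- A cycle is a closed directed walk of length ≥ 1 (so self-loops count).

HasCycle : (Colour → Colour → Bool) → Set
HasCycle R = ∃ λ v → TransClosure (λ a b → R a b ≡ true) v v

_∪ᴿ_ : (Colour → Colour → Bool) → (Colour → Colour → Bool) → (Colour → Colour → Bool)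
(R ∪ᴿ S) a b = R a b ∨ S a b

-- First-order logic over graphs with built-in order < and BIT.
-- Formulas with k free variables (de Bruijn indices in Fin k).

data Formula (k : ℕ) : Set where
  edge  : Fin k → Fin k → Formula k
  equal : Fin k → Fin k → Formula k
  less  : Fin k → Fin k → Formula k
  bit   : Fin k → Fin k → Formula k
  ¬'_   : Formula k → Formula k
  _∧'_  : Formula k → Formula k → Formula k
  _∨'_  : Formula k → Formula k → Formula k
  ∃'_   : Formula (suc k) → Formula k
  ∀'_   : Formula (suc k) → Formula k

bitOf : ℕ → ℕ → ℕ
bitOf i zero    = i % 2
bitOf i (suc j) = bitOf (i / 2) j

BIT : ℕ → ℕ → Set
BIT i j = bitOf i j ≡ 1

extend : ∀ {n k} → Fin n → (Fin k → Fin n) → Fin (suc k) → Fin n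
extend a ρ Fin.zero    = a
extend a ρ (Fin.suc i) = ρ i

Sat : ∀ {n k} → BasicGraph n → (Fin k → Fin n) → Formula k → Set
Sat G ρ (edge i j)  = adj G (ρ i) (ρ j) ≡ true
Sat G ρ (equal i j) = ρ i ≡ ρ j
Sat G ρ (less i j)  = ρ i < ρ j
Sat G ρ (bit i j)   = BIT (toℕ (ρ i)) (toℕ (ρ j))
Sat G ρ (¬' φ)      = ¬ Sat G ρ φ
Sat G ρ (φ ∧' ψ)    = Sat G ρ φ × Sat G ρ ψ
Sat G ρ (φ ∨' ψ)    = Sat G ρ φ ⊎ Sat G ρ ψ
Sat {n} G ρ (∃' φ)  = Σ (Fin n) λ a → Sat G (extend a ρ) φ
Sat {n} G ρ (∀' φ)  = (a : Fin n) → Sat G (extend a ρ) φ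

Sentence : Set
Sentence = Formula 0

noVars : ∀ {n} → Fin 0 → Fin n
noVars ()

-- A set of basic graphs is in FO (FO[<, BIT]) if some sentence defines it.
InFO : (∀ n → BasicGraph n → Set) → Set
InFO S = Σ Sentence λ φ → ∀ n (G : BasicGraph n) → S n G ⇔ Sat G noVars φ

module Submission where

-- Under the hypotheses the pattern is, up to exchanging the colours, A⊕ = {(black, white)} and
-- A⊖ = {(white, black)}.  So G is saturated iff some vertex set B is saturating: every vertex in B has a
-- neighbour outside B and every vertex outside B has a non-neighbour in B.  This happens iff G is empty or
-- has an incomparable pair s ≠ t, i.e. N(s) ⊄ N[t] and N(t) ⊄ N[s], which is first-order.
-- From a saturating set: take y ∉ B of maximal degree, a non-neighbour z ∈ B of y and a neighbour u ∉ B
-- of z; then (y, u) is incomparable, since N(y) ∖ {u} ⊆ N(u) would force deg u > deg y.  Conversely take an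
-- incomparable pair (s, t) maximising 2|U| + [s ~ t], where U = N(s) ∪ N(t) ∖ {s, t}, and let B = U.
-- A vertex y ∉ U ∪ {s, t} without a non-neighbour in U is adjacent to all of U, and then (y, s), (y, p)
-- or (p, q), for p ∈ N(s) ∖ N[t] and q ∈ N(t) ∖ N[s], is an incomparable pair of larger weight.

open import Defs hiding (sym)
open import Level using (Level; 0ℓ)
open import Data.Bool using (Bool; true; false; _∨_; if_then_else_)
import Data.Bool.Properties as Bool
open import Data.Nat using (ℕ; zero; suc; _+_; _*_; _≤_; _<_; z≤n; s≤s)
open import Data.Nat.Properties
  using (≤-refl; ≤-reflexive; ≤-trans; <⇒≱; m≤n⇒m≤1+n; m≤m+n; m≤n+m; +-identityʳ; +-suc; +-monoˡ-≤;
         +-mono-≤; +-cancelʳ-≤; *-suc; *-monoʳ-≤; module ≤-Reasoning)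
open import Data.Fin using (Fin; zero; suc)
import Data.Fin.Properties as Fin
open import Data.List using (List; []; _∷_; length)
open import Data.List.Membership.Propositional using (_∈_)
open import Data.List.Relation.Unary.All using (All; []; _∷_)
import Data.List.Relation.Unary.All as All
open import Data.List.Relation.Unary.Any using (here; there; any?)
open import Data.List.Relation.Unary.AllPairs using ([]; _∷_)
open import Data.List.Relation.Unary.Unique.Propositional using (Unique)
open import Data.Product using (Σ; ∃; ∃₂; _×_; _,_; proj₁; proj₂; uncurry)
import Data.Product as Product
open import Data.Sum using (_⊎_; inj₁; inj₂)
import Data.Sum as Sum
open import Function using (_∘_; id)
open import Function.Bundles using (_⇔_; mk⇔)
open import Relation.Nullary using (¬_; Dec; yes; no; does; contradiction)
open import Relation.Nullary.Decidable using (_×-dec_; _⊎-dec_; _→-dec_; ¬?; decidable-stable)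
open import Relation.Unary using (Pred; Decidable; _⊆_; _⊆′_; _∪_; _∖_; ｛_｝)
open import Relation.Unary.Properties using (_∪?_)
open import Relation.Binary.Definitions using (DecidableEquality)
open import Relation.Binary.PropositionalEquality using (_≡_; refl; sym; trans; _≢_; subst)
open import Relation.Binary.Construct.Closure.Transitive using (TransClosure; [_]; _∷_)

private variable
  a b p q : Level
  n : ℕ

count : {P : Pred (Fin n) p} → Decidable P → ℕ
count {n = zero}  P? = 0
count {n = suc n} P? = if does (P? zero) then suc (count (P? ∘ suc)) else count (P? ∘ suc)

count≤n : {P : Pred (Fin n) p} (P? : Decidable P) → count P? ≤ n
count≤n {n = zero}  P? = z≤n
count≤n {n = suc n} P? with P? zero
... | yes _ = s≤s (count≤n (P? ∘ suc))
... | no  _ = m≤n⇒m≤1+n (count≤n (P? ∘ suc))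

count-mono : {P : Pred (Fin n) p} {Q : Pred (Fin n) q} (P? : Decidable P) (Q? : Decidable Q) →
             P ⊆ Q → count P? ≤ count Q?
count-mono {n = zero}  P? Q? P⊆Q = z≤n
count-mono {n = suc n} P? Q? P⊆Q with P? zero | Q? zero
... | yes p₀ | no ¬q₀ = contradiction (P⊆Q p₀) ¬q₀
... | yes _  | yes _  = s≤s (count-mono (P? ∘ suc) (Q? ∘ suc) P⊆Q)
... | no  _  | yes _  = m≤n⇒m≤1+n (count-mono (P? ∘ suc) (Q? ∘ suc) P⊆Q)
... | no  _  | no  _  = count-mono (P? ∘ suc) (Q? ∘ suc) P⊆Q

count-mono-< : {P : Pred (Fin n) p} {Q : Pred (Fin n) q} (P? : Decidable P) (Q? : Decidable Q) {a : Fin n} →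
               P ⊆ Q → Q a → ¬ P a → count P? < count Q?
count-mono-< {n = suc n} P? Q? {a} P⊆Q Qa ¬Pa with P? zero | Q? zero | a
... | yes p₀ | no ¬q₀ | _      = contradiction (P⊆Q p₀) ¬q₀
... | no ¬p₀ | no ¬q₀ | zero   = contradiction Qa ¬q₀
... | yes p₀ | yes _  | zero   = contradiction p₀ ¬Pa
... | no  _  | yes _  | zero   = s≤s (count-mono (P? ∘ suc) (Q? ∘ suc) P⊆Q)
... | yes _  | yes _  | suc a′ = s≤s (count-mono-< (P? ∘ suc) (Q? ∘ suc) P⊆Q Qa ¬Pa)
... | no  _  | yes _  | suc a′ = m≤n⇒m≤1+n (count-mono-< (P? ∘ suc) (Q? ∘ suc) P⊆Q Qa ¬Pa)
... | no  _  | no  _  | suc a′ = count-mono-< (P? ∘ suc) (Q? ∘ suc) P⊆Q Qa ¬Pa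

count≤suc-tail : {P : Pred (Fin (suc n)) p} (P? : Decidable P) → count P? ≤ suc (count (P? ∘ suc))
count≤suc-tail P? with P? zero
... | yes _ = ≤-refl
... | no  _ = m≤n⇒m≤1+n ≤-refl

count-tail≤ : {P : Pred (Fin (suc n)) p} (P? : Decidable P) → count (P? ∘ suc) ≤ count P?
count-tail≤ P? with P? zero
... | yes _ = m≤n⇒m≤1+n ≤-refl
... | no  _ = ≤-refl

count-⊆∪｛｝ : {P : Pred (Fin n) p} {Q : Pred (Fin n) q} (P? : Decidable P) (Q? : Decidable Q) {a : Fin n} →
              P ⊆ Q ∪ ｛ a ｝ → count P? ≤ suc (count Q?)
count-⊆∪｛｝ {n = suc n} P? Q? {zero} P⊆Q∪a = ≤-trans (count≤suc-tail P?)
  (s≤s (≤-trans (count-mono (P? ∘ suc) (Q? ∘ suc) (λ Px → Sum.[ id , (λ ()) ] (P⊆Q∪a Px))) (count-tail≤ Q?)))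
count-⊆∪｛｝ {n = suc n} P? Q? {suc a} P⊆Q∪a
  with P? zero | Q? zero | count-⊆∪｛｝ (P? ∘ suc) (Q? ∘ suc) (λ Px → Sum.map₂ Fin.suc-injective (P⊆Q∪a Px))
... | yes p₀ | no ¬q₀ | _  = contradiction (Sum.[ id , (λ ()) ] (P⊆Q∪a p₀)) ¬q₀
... | yes _  | yes _  | IH = s≤s IH
... | no  _  | yes _  | IH = m≤n⇒m≤1+n IH
... | no  _  | no  _  | IH = IH

count-⊆∪∈ : {P : Pred (Fin n) p} {Q : Pred (Fin n) q} (P? : Decidable P) (Q? : Decidable Q) (ys : List (Fin n)) →
            P ⊆ Q ∪ (_∈ ys) → count P? ≤ count Q? + length ys
count-⊆∪∈ P? Q? [] P⊆Q = ≤-trans (count-mono P? Q? (λ Px → Sum.[ id , (λ ()) ] (P⊆Q Px))) (m≤m+n _ 0)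
count-⊆∪∈ {P = P} {Q = Q} P? Q? (y ∷ ys) P⊆Q∪y∷ys = begin
  count P?                   ≤⟨ count-⊆∪∈ P? Q∪y? ys P⊆Q∪y∪ys ⟩
  count Q∪y? + length ys     ≤⟨ +-monoˡ-≤ (length ys) (count-⊆∪｛｝ Q∪y? Q? id) ⟩
  suc (count Q?) + length ys ≡⟨ sym (+-suc _ _) ⟩
  count Q? + length (y ∷ ys) ∎
  where
  open ≤-Reasoning
  Q∪y? : Decidable (Q ∪ ｛ y ｝)
  Q∪y? = Q? ∪? (y Fin.≟_)
  P⊆Q∪y∪ys : P ⊆ (Q ∪ ｛ y ｝) ∪ (_∈ ys)
  P⊆Q∪y∪ys Px with P⊆Q∪y∷ys Px
  ... | inj₁ Qx           = inj₁ (inj₁ Qx)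
  ... | inj₂ (here refl)  = inj₁ (inj₂ refl)
  ... | inj₂ (there x∈ys) = inj₂ x∈ys

count+length≤count : {P : Pred (Fin n) p} {Q : Pred (Fin n) q} (P? : Decidable P) (Q? : Decidable Q) →
                     {xs : List (Fin n)} → P ⊆ Q → All (Q ∖ P) xs → Unique xs → count P? + length xs ≤ count Q?
count+length≤count P? Q? P⊆Q [] [] = ≤-trans (≤-reflexive (+-identityʳ _)) (count-mono P? Q? P⊆Q)
count+length≤count {P = P} {Q = Q} P? Q? {x ∷ xs} P⊆Q ((Qx , ¬Px) ∷ new) (x∉xs ∷ unique) = begin
  count P? + suc (length xs) ≡⟨ +-suc _ _ ⟩
  suc (count P?) + length xs ≤⟨ +-monoˡ-≤ (length xs) (count-mono-< P? P∪x? inj₁ (inj₂ refl) ¬Px) ⟩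
  count P∪x? + length xs     ≤⟨ count+length≤count P∪x? Q? P∪x⊆Q (All.zipWith new′ (x∉xs , new)) unique ⟩
  count Q?                   ∎
  where
  open ≤-Reasoning
  P∪x? : Decidable (P ∪ ｛ x ｝)
  P∪x? = P? ∪? (x Fin.≟_)
  P∪x⊆Q : P ∪ ｛ x ｝ ⊆ Q
  P∪x⊆Q (inj₁ Py)   = P⊆Q Py
  P∪x⊆Q (inj₂ refl) = Qx
  new′ : ∀ {y} → x ≢ y × (Q ∖ P) y → (Q ∖ (P ∪ ｛ x ｝)) y
  new′ (x≢y , Qy , ¬Py) = Qy , Sum.[ ¬Py , x≢y ]

count-exchange : {P : Pred (Fin n) p} {Q : Pred (Fin n) q} (P? : Decidable P) (Q? : Decidable Q) →
                 {xs ys : List (Fin n)} → P ⊆ Q ∪ (_∈ ys) → All (Q ∖ P) xs → Unique xs →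
                 count P? + length xs ≤ count Q? + length ys
count-exchange {Q = Q} P? Q? {ys = ys} P⊆Q∪ys new unique = ≤-trans
  (count+length≤count P? Q∪ys? P⊆Q∪ys (All.map (Product.map₁ inj₁) new) unique)
  (count-⊆∪∈ Q∪ys? Q? ys id)
  where
  Q∪ys? : Decidable (Q ∪ (_∈ ys))
  Q∪ys? = Q? ∪? λ x → any? (x Fin.≟_) ys

∉×∈⇒≢ : {A : Set a} {B : Pred A p} {x y : A} → ¬ B x → B y → x ≢ y
∉×∈⇒≢ ¬Bx By refl = ¬Bx By

bounded-ascent : {A : Set a} {P : A → Set p} {B : Set b} (f : A → ℕ) {bound : ℕ} →
                 (∀ x → f x ≤ bound) → (∀ {x} → P x → B ⊎ ∃ λ y → P y × f x < f y) →
                 ∀ {x} → P x → B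
bounded-ascent {P = P} {B = B} f {bound} f≤bound step = climb bound (m≤n+m bound _)
  where
  climb : ∀ k {x} → bound ≤ f x + k → P x → B
  climb k {x} bound≤ Px with step Px
  ... | inj₁ done = done
  ... | inj₂ (y , Py , fx<fy) with k
  ...   | zero  = contradiction (≤-trans (f≤bound y) (≤-trans bound≤ (≤-reflexive (+-identityʳ (f x)))))
                                (<⇒≱ fx<fy)
  ...   | suc k = climb k (≤-trans bound≤ (≤-trans (≤-reflexive (+-suc (f x) k)) (+-monoˡ-≤ k fx<fy))) Py

other : Colour → Colour
other black = white
other white = black

other-≢ : ∀ c → other c ≢ c
other-≢ black ()
other-≢ white ()

_≟ᶜ_ : DecidableEquality Colour
black ≟ᶜ black = yes refl
black ≟ᶜ white = no λ ()
white ≟ᶜ black = no λ ()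
white ≟ᶜ white = yes refl

Arc : (Colour → Colour → Bool) → Colour → Colour → Set
Arc R a b = R a b ≡ true

Loop : (Colour → Colour → Bool) → Set
Loop R = ∃ λ c → Arc R c c

Swap : (Colour → Colour → Bool) → Set
Swap R = Arc R black white × Arc R white black

-- Two colours: a two-step walk a → c → b has a loop unless a ≢ c ≢ b, and then a ≡ b.
shortcut : {R : Colour → Colour → Bool} {a b : Colour} →
           TransClosure (Arc R) a b → Loop R ⊎ Swap R ⊎ Arc R a b
shortcut [ r ] = inj₂ (inj₂ r)
shortcut {R} (_∷_ {a} {c} r rest) with shortcut rest
... | inj₁ loop         = inj₁ loop
... | inj₂ (inj₁ swap)  = inj₂ (inj₁ swap)
... | inj₂ (inj₂ r′)    = triangle a c _ r r′
  where
  triangle : ∀ a c b → Arc R a c → Arc R c b → Loop R ⊎ Swap R ⊎ Arc R a b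
  triangle black black _     r _  = inj₁ (black , r)
  triangle white white _     r _  = inj₁ (white , r)
  triangle _     black black _ r′ = inj₁ (black , r′)
  triangle _     white white _ r′ = inj₁ (white , r′)
  triangle black white black r r′ = inj₂ (inj₁ (r , r′))
  triangle white black white r r′ = inj₂ (inj₁ (r′ , r))

cycle⇒loop⊎swap : {R : Colour → Colour → Bool} → HasCycle R → Loop R ⊎ Swap R
cycle⇒loop⊎swap (v , walk) with shortcut walk
... | inj₁ loop        = inj₁ loop
... | inj₂ (inj₁ swap) = inj₂ swap
... | inj₂ (inj₂ r)    = inj₁ (v , r)

acyclic-only : {R : Colour → Colour → Bool} → ¬ HasCycle R →
               ∀ c {a b} → Arc R c (other c) → Arc R a b → a ≡ c × b ≡ other c
acyclic-only ¬cyc black {black} {black} _  r = contradiction (black , [ r ]) ¬cyc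
acyclic-only ¬cyc black {black} {white} _  _ = refl , refl
acyclic-only ¬cyc black {white} {black} r₀ r = contradiction (black , r₀ ∷ [ r ]) ¬cyc
acyclic-only ¬cyc black {white} {white} _  r = contradiction (white , [ r ]) ¬cyc
acyclic-only ¬cyc white {black} {black} _  r = contradiction (black , [ r ]) ¬cyc
acyclic-only ¬cyc white {black} {white} r₀ r = contradiction (black , r ∷ [ r₀ ]) ¬cyc
acyclic-only ¬cyc white {white} {black} _  _ = refl , refl
acyclic-only ¬cyc white {white} {white} _  r = contradiction (white , [ r ]) ¬cyc

record Alternating (P : Pattern) (c : Colour) : Set where
  field
    ⊕-arc  : Arc (A⊕ P) c (other c)
    ⊖-arc  : Arc (A⊖ P) (other c) c
    ⊕-only : ∀ {a b} → Arc (A⊕ P) a b → a ≡ c × b ≡ other c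
    ⊖-only : ∀ {a b} → Arc (A⊖ P) a b → a ≡ other c × b ≡ c

∨-≡true : ∀ {x y} → x ∨ y ≡ true → x ≡ true ⊎ y ≡ true
∨-≡true {true}  _ = inj₁ refl
∨-≡true {false} e = inj₂ e

alternating : (P : Pattern) → HasCycle (A⊕ P ∪ᴿ A⊖ P) → ¬ HasCycle (A⊕ P) → ¬ HasCycle (A⊖ P) →
              ∃ (Alternating P)
alternating P cyc ¬cyc⊕ ¬cyc⊖ with cycle⇒loop⊎swap cyc
... | inj₁ (c , loop) =
  Sum.[ (λ r → contradiction (c , [ r ]) ¬cyc⊕) , (λ r → contradiction (c , [ r ]) ¬cyc⊖) ] (∨-≡true loop)
... | inj₂ (bw , wb) with ∨-≡true bw | ∨-≡true wb
...   | inj₁ bw⊕ | inj₁ wb⊕ = contradiction (black , bw⊕ ∷ [ wb⊕ ]) ¬cyc⊕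
...   | inj₂ bw⊖ | inj₂ wb⊖ = contradiction (black , bw⊖ ∷ [ wb⊖ ]) ¬cyc⊖
...   | inj₁ bw⊕ | inj₂ wb⊖ = black , record
  { ⊕-arc = bw⊕ ; ⊖-arc = wb⊖
  ; ⊕-only = acyclic-only ¬cyc⊕ black bw⊕ ; ⊖-only = acyclic-only ¬cyc⊖ white wb⊖ }
...   | inj₂ bw⊖ | inj₁ wb⊕ = white , record
  { ⊕-arc = wb⊕ ; ⊖-arc = bw⊖
  ; ⊕-only = acyclic-only ¬cyc⊕ white wb⊕ ; ⊖-only = acyclic-only ¬cyc⊖ black bw⊖ }

+-suc-≤⇒< : ∀ {m n} k → m + suc k ≤ n + k → m < n
+-suc-≤⇒< {m} {n} k le = +-cancelʳ-≤ k (suc m) n (≤-trans (≤-reflexive (sym (+-suc m k))) le)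

module _ {n : ℕ} (G : BasicGraph n) where

  E : Fin n → Fin n → Set
  E x y = adj G x y ≡ true

  E? : ∀ x y → Dec (E x y)
  E? x y = adj G x y Bool.≟ true

  E-sym : ∀ {x y} → E x y → E y x
  E-sym {x} {y} e = trans (BasicGraph.sym G y x) e

  E⇒≢ : ∀ {x y} → E x y → x ≢ y
  E⇒≢ {x} e refl = contradiction (trans (sym e) (irrefl G x)) λ ()

  deg : Fin n → ℕ
  deg x = count (E? x)

  deg-< : ∀ {y z u} → E z u → ¬ E y z → y ≢ z → E y ⊆ E u ∪ ｛ u ｝ → deg y < deg u
  deg-< {y} {z} {u} Ezu ¬Eyz y≢z Ny⊆Nu∪u with E? y u
  ... | yes Eyu = +-suc-≤⇒< 1 (count-exchange (E? y) (E? u) incl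
          ((E-sym Ezu , ¬Eyz) ∷ (E-sym Eyu , λ Eyy → E⇒≢ Eyy refl) ∷ []) ((y≢z ∘ sym ∷ []) ∷ [] ∷ []))
    where
    incl : E y ⊆ E u ∪ (_∈ u ∷ [])
    incl Eyr = Sum.map₂ (λ { refl → here refl }) (Ny⊆Nu∪u Eyr)
  ... | no ¬Eyu = +-suc-≤⇒< 0 (count-exchange (E? y) (E? u) incl ((E-sym Ezu , ¬Eyz) ∷ []) ([] ∷ []))
    where
    incl : E y ⊆ E u ∪ (_∈ [])
    incl Eyr = inj₁ (Sum.[ id , (λ { refl → contradiction Eyr ¬Eyu }) ] (Ny⊆Nu∪u Eyr))

  record SaturatingSet {ℓ} (B : Pred (Fin n) ℓ) : Set ℓ where
    field
      inside-witness  : ∀ {x} → B x → ∃ λ y → E x y × ¬ B y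
      outside-witness : ∀ {x} → ¬ B x → ∃ λ y → ¬ E x y × B y

  Incomparable : Fin n → Fin n → Set
  Incomparable s t = t ≢ s × (∃ λ p → E p s × p ≢ t × ¬ E p t) × (∃ λ q → E q t × q ≢ s × ¬ E q s)

  saturating⇒incomparable : ∀ {ℓ} {B : Pred (Fin n) ℓ} → Fin n → Decidable B → SaturatingSet B →
                            ∃₂ Incomparable
  saturating⇒incomparable {B = B} x₀ B? sat = bounded-ascent deg (count≤n ∘ E?) step (proj₂ outsider)
    where
    open SaturatingSet sat

    outsider : ∃ λ y → ¬ B y
    outsider with B? x₀
    ... | yes Bx₀ = Product.map₂ proj₂ (inside-witness Bx₀)
    ... | no ¬Bx₀ = x₀ , ¬Bx₀

    step : ∀ {y} → ¬ B y → ∃₂ Incomparable ⊎ ∃ λ u → ¬ B u × deg y < deg u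
    step {y} ¬By with outside-witness ¬By
    ... | z , ¬Eyz , Bz with inside-witness Bz
    ...   | u , Ezu , ¬Bu with Fin.any? (λ r → E? y r ×-dec ¬? (r Fin.≟ u) ×-dec ¬? (E? u r))
    ...     | yes (r , Eyr , r≢u , ¬Eur) =
                inj₁ (y , u , u≢y , (r , E-sym Eyr , r≢u , ¬Eur ∘ E-sym)
                                  , (z , Ezu , ∉×∈⇒≢ {B = B} ¬By Bz ∘ sym , ¬Eyz ∘ E-sym))
      where
      u≢y : u ≢ y
      u≢y refl = ¬Eyz (E-sym Ezu)
    ...     | no ¬r = inj₂ (u , ¬Bu , deg-< Ezu ¬Eyz (∉×∈⇒≢ {B = B} ¬By Bz) Ny⊆Nu∪u)
      where
      Ny⊆Nu∪u : E y ⊆ E u ∪ ｛ u ｝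
      Ny⊆Nu∪u {r} Eyr with r Fin.≟ u
      ... | yes refl = inj₂ refl
      ... | no r≢u   = inj₁ (decidable-stable (E? u r) λ ¬Eur → ¬r (r , Eyr , r≢u , ¬Eur))

  JointNbhd : Fin n → Fin n → Pred (Fin n) 0ℓ
  JointNbhd s t x = (E s x ⊎ E t x) × x ≢ s × x ≢ t

  JointNbhd? : ∀ s t → Decidable (JointNbhd s t)
  JointNbhd? s t x = (E? s x ⊎-dec E? t x) ×-dec ¬? (x Fin.≟ s) ×-dec ¬? (x Fin.≟ t)

  jointDeg : Fin n → Fin n → ℕ
  jointDeg s t = count (JointNbhd? s t)

  edgeBit : Fin n → Fin n → ℕ
  edgeBit s t = if adj G s t then 1 else 0

  edgeBit≤1 : ∀ s t → edgeBit s t ≤ 1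
  edgeBit≤1 s t with adj G s t
  ... | true  = ≤-refl
  ... | false = z≤n

  weight : Fin n → Fin n → ℕ
  weight s t = edgeBit s t + 2 * jointDeg s t

  weight≤ : ∀ s t → weight s t ≤ 1 + 2 * n
  weight≤ s t = +-mono-≤ (edgeBit≤1 s t) (*-monoʳ-≤ 2 (count≤n (JointNbhd? s t)))

  weight-<-joint : ∀ {s t a b} → jointDeg s t < jointDeg a b → weight s t < weight a b
  weight-<-joint {s} {t} {a} {b} j<j′ = begin-strict
    edgeBit s t + 2 * jointDeg s t ≤⟨ +-monoˡ-≤ (2 * jointDeg s t) (edgeBit≤1 s t) ⟩
    1 + 2 * jointDeg s t           <⟨ ≤-refl ⟩
    2 + 2 * jointDeg s t           ≡⟨ sym (*-suc 2 (jointDeg s t)) ⟩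
    2 * suc (jointDeg s t)         ≤⟨ *-monoʳ-≤ 2 j<j′ ⟩
    2 * jointDeg a b               ≤⟨ m≤n+m (2 * jointDeg a b) (edgeBit a b) ⟩
    edgeBit a b + 2 * jointDeg a b ∎
    where open ≤-Reasoning

  weight-<-edge : ∀ {s t a b} → ¬ E s t → E a b → jointDeg s t ≤ jointDeg a b → weight s t < weight a b
  weight-<-edge {s} {t} {a} {b} ¬Est Eab j≤j′ with adj G s t | adj G a b
  ... | true  | _     = contradiction refl ¬Est
  ... | false | true  = s≤s (*-monoʳ-≤ 2 j≤j′)
  ... | false | false = contradiction Eab λ ()

  Dominates : Fin n → Fin n → Fin n → Set
  Dominates s t y = y ≢ s × y ≢ t × ¬ E s y × ¬ E t y × JointNbhd s t ⊆′ E y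

  Dominates? : ∀ s t → Decidable (Dominates s t)
  Dominates? s t y = ¬? (y Fin.≟ s) ×-dec ¬? (y Fin.≟ t) ×-dec ¬? (E? s y) ×-dec ¬? (E? t y)
                     ×-dec Fin.all? (λ z → JointNbhd? s t z →-dec E? y z)

  module Improvement {s t p q y : Fin n}
           (t≢s : t ≢ s) (Eps : E p s) (p≢t : p ≢ t) (¬Ept : ¬ E p t) (Eqt : E q t) (q≢s : q ≢ s) (¬Eqs : ¬ E q s)
           (y≢s : y ≢ s) (y≢t : y ≢ t) (¬Esy : ¬ E s y) (¬Ety : ¬ E t y) (U⊆Ny : JointNbhd s t ⊆′ E y) where

    private
      Up : JointNbhd s t p
      Up = inj₁ (E-sym Eps) , E⇒≢ Eps , p≢t

      Uq : JointNbhd s t q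
      Uq = inj₂ (E-sym Eqt) , q≢s , E⇒≢ Eqt

      U⇒≢y : ∀ {x} → JointNbhd s t x → x ≢ y
      U⇒≢y (inj₁ Esy , _) refl = ¬Esy Esy
      U⇒≢y (inj₂ Ety , _) refl = ¬Ety Ety

      y∉U : ¬ JointNbhd s t y
      y∉U Uy = U⇒≢y Uy refl

      s∉U : ¬ JointNbhd s t s
      s∉U (_ , s≢s , _) = s≢s refl

      t∉U : ¬ JointNbhd s t t
      t∉U (_ , _ , t≢t) = t≢t refl

    improve-adjacent : E s t → Incomparable y s × weight s t < weight y s
    improve-adjacent Est =
        (y≢s ∘ sym , (q , E-sym (U⊆Ny q Uq) , q≢s , ¬Eqs) , (t , E-sym Est , y≢t ∘ sym , ¬Ety))
      , weight-<-joint (+-suc-≤⇒< 0 (count-exchange (JointNbhd? s t) (JointNbhd? y s) incl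
                          (((inj₂ Est , y≢t ∘ sym , t≢s) , t∉U) ∷ []) ([] ∷ [])))
      where
      incl : JointNbhd s t ⊆ JointNbhd y s ∪ (_∈ [])
      incl {x} Ux@(_ , x≢s , _) = inj₁ (inj₁ (U⊆Ny x Ux) , U⇒≢y Ux , x≢s)

    improve-escape : ¬ E s t → ∀ {r} → E y r → r ≢ p → ¬ E p r → Incomparable y p × weight s t < weight y p
    improve-escape ¬Est {r} Eyr r≢p ¬Epr =
        (U⇒≢y Up , (r , E-sym Eyr , r≢p , ¬Epr ∘ E-sym) , (s , E-sym Eps , y≢s ∘ sym , ¬Esy))
      , weight-<-edge ¬Est (U⊆Ny p Up) (+-cancelʳ-≤ 1 _ _ (count-exchange (JointNbhd? s t) (JointNbhd? y p) incl
                          (((inj₂ Eps , y≢s ∘ sym , E⇒≢ Eps ∘ sym) , s∉U) ∷ []) ([] ∷ [])))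
      where
      incl : JointNbhd s t ⊆ JointNbhd y p ∪ (_∈ p ∷ [])
      incl {x} Ux with x Fin.≟ p
      ... | yes refl = inj₂ (here refl)
      ... | no x≢p   = inj₁ (inj₁ (U⊆Ny x Ux) , U⇒≢y Ux , x≢p)

    improve-nested : ¬ E s t → E y ⊆ E p ∪ ｛ p ｝ → Incomparable p q × weight s t < weight p q
    improve-nested ¬Est Ny⊆Np∪p =
        ( (λ { refl → ¬Ept Eqt })
        , (s , E-sym Eps , q≢s ∘ sym , ¬Eqs ∘ E-sym)
        , (t , E-sym Eqt , p≢t ∘ sym , ¬Ept ∘ E-sym))
      , weight-<-joint (+-suc-≤⇒< 2 (count-exchange (JointNbhd? s t) (JointNbhd? p q) incl
                          ( ((inj₁ Eps , E⇒≢ Eps ∘ sym , q≢s ∘ sym) , s∉U)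
                          ∷ ((inj₂ Eqt , p≢t ∘ sym , E⇒≢ Eqt ∘ sym) , t∉U)
                          ∷ ((inj₁ (E-sym (U⊆Ny p Up)) , U⇒≢y Up ∘ sym , U⇒≢y Uq ∘ sym) , y∉U) ∷ [])
                          ((t≢s ∘ sym ∷ y≢s ∘ sym ∷ []) ∷ (y≢t ∘ sym ∷ []) ∷ [] ∷ [])))
      where
      incl : JointNbhd s t ⊆ JointNbhd p q ∪ (_∈ p ∷ q ∷ [])
      incl {x} Ux with x Fin.≟ p | x Fin.≟ q
      ... | yes refl | _        = inj₂ (here refl)
      ... | no _     | yes refl = inj₂ (there (here refl))
      ... | no x≢p   | no x≢q   = inj₁ (inj₁ Epx , x≢p , x≢q)
        where
        Epx : E p x
        Epx = Sum.[ id , (λ { refl → contradiction refl x≢p }) ] (Ny⊆Np∪p (U⊆Ny x Ux))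

  improve : ∀ {s t y} → Incomparable s t → Dominates s t y →
            ∃₂ λ a b → Incomparable a b × weight s t < weight a b
  improve {s} {t} {y} (t≢s , (p , Eps , p≢t , ¬Ept) , (q , Eqt , q≢s , ¬Eqs)) (y≢s , y≢t , ¬Esy , ¬Ety , U⊆Ny) =
    by-cases (E? s t) (Fin.any? λ r → E? y r ×-dec ¬? (r Fin.≟ p) ×-dec ¬? (E? p r))
    where
    open Improvement t≢s Eps p≢t ¬Ept Eqt q≢s ¬Eqs y≢s y≢t ¬Esy ¬Ety U⊆Ny
    by-cases : Dec (E s t) → Dec (∃ λ r → E y r × r ≢ p × ¬ E p r) →
               ∃₂ λ a b → Incomparable a b × weight s t < weight a b
    by-cases (yes Est) _                             = y , s , improve-adjacent Est
    by-cases (no ¬Est) (yes (r , Eyr , r≢p , ¬Epr)) = y , p , improve-escape ¬Est Eyr r≢p ¬Epr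
    by-cases (no ¬Est) (no ¬r)                       = p , q , improve-nested ¬Est Ny⊆Np∪p
      where
      Ny⊆Np∪p : E y ⊆ E p ∪ ｛ p ｝
      Ny⊆Np∪p {r} Eyr with r Fin.≟ p
      ... | yes refl = inj₂ refl
      ... | no r≢p   = inj₁ (decidable-stable (E? p r) λ ¬Epr → ¬r (r , Eyr , r≢p , ¬Epr))

  saturate-or-improve : ∀ {s t} → Incomparable s t →
                        SaturatingSet (JointNbhd s t) ⊎ ∃₂ λ a b → Incomparable a b × weight s t < weight a b
  saturate-or-improve {s} {t} inc@(_ , (p , Eps , p≢t , ¬Ept) , (q , Eqt , q≢s , ¬Eqs)) with Fin.any? (Dominates? s t)
  ... | yes (y , dom) = inj₂ (improve inc dom)
  ... | no ¬dom       = inj₁ record { inside-witness = inside ; outside-witness = outside }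
    where
    inside : ∀ {x} → JointNbhd s t x → ∃ λ y → E x y × ¬ JointNbhd s t y
    inside (inj₁ Esx , _) = s , E-sym Esx , λ (_ , s≢s , _) → s≢s refl
    inside (inj₂ Etx , _) = t , E-sym Etx , λ (_ , _ , t≢t) → t≢t refl

    outside : ∀ {x} → ¬ JointNbhd s t x → ∃ λ y → ¬ E x y × JointNbhd s t y
    outside {x} ¬Ux with x Fin.≟ s | x Fin.≟ t
    ... | yes refl | _        = q , ¬Eqs ∘ E-sym , inj₂ (E-sym Eqt) , q≢s , E⇒≢ Eqt
    ... | no _     | yes refl = p , ¬Ept ∘ E-sym , inj₁ (E-sym Eps) , E⇒≢ Eps , p≢t
    ... | no x≢s   | no x≢t
      with Fin.¬∀⟶∃¬ n _ (λ z → JointNbhd? s t z →-dec E? x z)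
             (λ U⊆Nx → ¬dom (x , x≢s , x≢t , (λ Esx → ¬Ux (inj₁ Esx , x≢s , x≢t))
                                           , (λ Etx → ¬Ux (inj₂ Etx , x≢s , x≢t)) , U⊆Nx))
    ...   | z , ¬[Uz→Exz] = z , (λ Exz → ¬[Uz→Exz] λ _ → Exz)
                              , decidable-stable (JointNbhd? s t z) (λ ¬Uz → ¬[Uz→Exz] λ Uz → contradiction Uz ¬Uz)

  incomparable⇒saturating : ∀ {s t} → Incomparable s t → ∃₂ λ a b → SaturatingSet (JointNbhd a b)
  incomparable⇒saturating {s} {t} = bounded-ascent (uncurry weight) (uncurry weight≤) step {s , t}
    where
    step : ∀ {st} → uncurry Incomparable st → (∃₂ λ a b → SaturatingSet (JointNbhd a b))
           ⊎ ∃ λ ab → uncurry Incomparable ab × uncurry weight st < uncurry weight ab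
    step {s , t} inc =
      Sum.map (λ sat → s , t , sat) (λ (a , b , inc′ , <w) → (a , b) , inc′ , <w) (saturate-or-improve inc)

-- s and t are the de Bruijn variables 1 and 0; p and q are then bound as 0.
incomparablePair : Formula 2
incomparablePair =
  (¬' equal zero (suc zero))
  ∧' ((∃' (edge zero (suc (suc zero)) ∧' ((¬' equal zero (suc zero)) ∧' (¬' edge zero (suc zero)))))
  ∧' (∃' (edge zero (suc zero) ∧' ((¬' equal zero (suc (suc zero))) ∧' (¬' edge zero (suc (suc zero)))))))

saturationSentence : Sentence
saturationSentence = (∃' (∃' incomparablePair)) ∨' (¬' (∃' equal zero zero))

vertex-or-empty : ∀ n → Fin n ⊎ ¬ Fin n
vertex-or-empty zero    = inj₂ λ ()
vertex-or-empty (suc n) = inj₁ zero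

module _ {P : Pattern} {c : Colour} (alt : Alternating P c) {n : ℕ} (G : BasicGraph n) where
  open Alternating alt

  saturation⇒saturatingSet : ∀ {col w} → IsWitness P G col w → SaturatingSet G (λ x → col x ≡ c)
  saturation⇒saturatingSet {col} {w} witness = record { inside-witness = inside ; outside-witness = outside }
    where
    inside : ∀ {x} → col x ≡ c → ∃ λ y → E G x y × col y ≢ c
    inside {x} cx≡c with adj G x (w x) in e | witness x
    ... | true  | _ , ⊕ , _ = w x , e , λ cy≡c → other-≢ c (trans (sym (proj₂ (⊕-only (⊕ refl)))) cy≡c)
    ... | false | _ , _ , ⊖ = contradiction (trans (sym (proj₁ (⊖-only (⊖ refl)))) cx≡c) (other-≢ c)

    outside : ∀ {x} → col x ≢ c → ∃ λ y → ¬ E G x y × col y ≡ c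
    outside {x} cx≢c with adj G x (w x) in e | witness x
    ... | true  | _ , ⊕ , _ = contradiction (proj₁ (⊕-only (⊕ refl))) cx≢c
    ... | false | _ , _ , ⊖ = w x , (λ e′ → contradiction (trans (sym e) e′) λ ()) , proj₂ (⊖-only (⊖ refl))

  saturatingSet⇒saturation : ∀ {ℓ} {B : Pred (Fin n) ℓ} → Decidable B → SaturatingSet G B → Saturation P n G
  saturatingSet⇒saturation {B = B} B? sat = colour , (proj₁ ∘ choice) , (proj₂ ∘ choice)
    where
    open SaturatingSet sat

    colour : Fin n → Colour
    colour x = if does (B? x) then c else other c

    colour-∈ : ∀ {x} → B x → colour x ≡ c
    colour-∈ {x} Bx with B? x
    ... | yes _  = refl
    ... | no ¬Bx = contradiction Bx ¬Bx

    colour-∉ : ∀ {x} → ¬ B x → colour x ≡ other c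
    colour-∉ {x} ¬Bx with B? x
    ... | yes Bx = contradiction Bx ¬Bx
    ... | no _   = refl

    choice : ∀ x → Σ (Fin n) λ y → x ≢ y
             × (adj G x y ≡ true  → A⊕ P (colour x) (colour y) ≡ true)
             × (adj G x y ≡ false → A⊖ P (colour x) (colour y) ≡ true)
    choice x with B? x
    ... | yes Bx = let y , Exy , ¬By = inside-witness Bx in
        y , E⇒≢ G Exy
          , (λ _ → subst (Arc (A⊕ P) c) (sym (colour-∉ ¬By)) ⊕-arc)
          , (λ ¬adj → contradiction (trans (sym Exy) ¬adj) λ ())
    ... | no ¬Bx = let y , ¬Exy , By = outside-witness ¬Bx in
        y , ∉×∈⇒≢ {B = B} ¬Bx By
          , (λ adj → contradiction adj ¬Exy)
          , (λ _ → subst (Arc (A⊖ P) (other c)) (sym (colour-∈ By)) ⊖-arc)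

  saturation⇔sentence : Saturation P n G ⇔ Sat G noVars saturationSentence
  saturation⇔sentence = mk⇔ to from
    where
    to : Saturation P n G → Sat G noVars saturationSentence
    to (col , w , witness) with vertex-or-empty n
    ... | inj₁ x₀    =
      inj₁ (saturating⇒incomparable G x₀ (λ x → col x ≟ᶜ c) (saturation⇒saturatingSet witness))
    ... | inj₂ empty = inj₂ (empty ∘ proj₁)

    from : Sat G noVars saturationSentence → Saturation P n G
    from (inj₁ (s , t , inc)) with incomparable⇒saturating G inc
    ... | a , b , sat = saturatingSet⇒saturation (JointNbhd? G a b) sat
    from (inj₂ empty) = absurd , absurd , absurd
      where
      absurd : ∀ {A : Fin n → Set} → (x : Fin n) → A x
      absurd x = contradiction (x , refl) empty

lemma22 : (P : Pattern) →
    HasCycle (A⊕ P ∪ᴿ A⊖ P) →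
    ¬ HasCycle (A⊕ P) →
    ¬ HasCycle (A⊖ P) →
    InFO (Saturation P)
lemma22 P cycle ¬cycle⊕ ¬cycle⊖ with alternating P cycle ¬cycle⊕ ¬cycle⊖
... | _ , alt = saturationSentence , λ _ → saturation⇔sentence alt
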